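{- Let $k$ be a positive integer and $r=\lfloor\log_2(k)\rfloor+1$. For every positive integer $m$, with $n=2^r m+k-1$, the perturbation $\sigma_{n,k}+X_1$ (a polynomial in $X_1,\dots,X_n$) is balanced, and in fact trivially balanced.
   Context: $\sigma_{n,k}$ is the elementary symmetric polynomial of degree $k$ in $X_1,\dots,X_n$ over $\mathbb{F}_2$. For a Boolean polynomial $G$ in $N$ variables, $S(G)=\sum_{x\in\mathbb{F}_2^N}(-1)^{G(x)}$ and $G$ is balanced if $S(G)=0$. General notion of trivial balancedness: for integers $1\le k_1<\dots<k_s$, $j\ge 0$, a Boolean polynomial $F$ in $X_1,\dots,X_j$ and $n\geq 0$, consider $G=\sigma_{n+j,k_1}+\cdots+\sigma_{n+j,k_s}+F$ in $n+j$ variables. Put $C_m(F)=\sum_{x\in\mathbb{F}_2^j,\ w(x)=m}(-1)^{F(x)}$ ($w$ = Hamming weight) and, for integers $l\ge0$, $\delta_l=\sum_{m=0}^{j}C_m(F)(-1)^{\binom{l+m}{k_1}+\cdots+\binom{l+m}{k_s}}$, so that $S(G)=\sum_{l=0}^{n}\delta_l\binom{n}{l}$. $G$ is called trivially balanced if there is an integer $c$ with $\delta_l+\delta_{n-l}=c(-1)^l$ for all $0\le l\le n$ (i.e. the solution $(\delta_0,\dots,\delta_n)$ of $\sum_l x_l\binom{n}{l}=0$ is equivalent, up to scaling and using $\binom{n}{l}=\binom{n}{n-l}$, to an antisymmetric solution or to the alternating solution $x_l=(-1)^l$). Here $s=1$, $k_1=k$, $j=1$, $F=X_1$, and the relevant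 $n$ in this definition is $2^rm+k-2$. -}

module Defs where

open import Data.Bool using (Bool; true; false; _xor_; _∧_; if_then_else_)
open import Data.Nat as ℕ using (ℕ; zero; suc)
open import Data.Nat.Combinatorics using (_C_)
open import Data.Integer using (ℤ; +_; -_; _+_; _-_; _*_)
open import Data.List using (List; []; _∷_; map; concatMap; filterᵇ; upTo; foldr)
open import Data.Vec using (Vec; []; _∷_; head)
open import Data.Product using (Σ)
open import Relation.Binary.PropositionalEquality using (_≡_)

sumℤ : List ℤ → ℤ
sumℤ = foldr _+_ (+ 0)

-- All points of F_2^N (true = 1, false = 0)
allVecs : (N : ℕ) → List (Vec Bool N)
allVecs zero = [] ∷ []
allVecs (suc N) = concatMap (λ v → (false ∷ v) ∷ (true ∷ v) ∷ []) (allVecs N)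

sgn : Bool → ℤ
sgn true  = - (+ 1)
sgn false = + 1

negOnePow : ℕ → ℤ
negOnePow zero = + 1
negOnePow (suc n) = - negOnePow n

weight : ∀ {N} → Vec Bool N → ℕ
weight [] = 0
weight (true ∷ v) = suc (weight v)
weight (false ∷ v) = weight v

-- Evaluation of the elementary symmetric polynomial σ_{N,k} over F_2,
-- via the standard recursion e_k(x,xs) = e_k(xs) + x * e_{k-1}(xs), e_0 = 1.
σ : ∀ {N} → ℕ → Vec Bool N → Bool
σ zero    _        = true
σ (suc k) []       = false
σ (suc k) (x ∷ xs) = σ (suc k) xs xor (x ∧ σ k xs)

S : (N : ℕ) → (Vec Bool N → Bool) → ℤ
S N G = sumℤ (map (λ x → sgn (G x)) (allVecs N))

Balanced : (N : ℕ) → (Vec Bool N → Bool) → Set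
Balanced N G = S N G ≡ + 0

Cm : (j : ℕ) → (Vec Bool j → Bool) → ℕ → ℤ
Cm j F m = sumℤ (map (λ x → sgn (F x)) (filterᵇ (λ x → weight x ℕ.≡ᵇ m) (allVecs j)))

δ : List ℕ → (j : ℕ) → (Vec Bool j → Bool) → ℕ → ℤ
δ ks j F l = sumℤ (map (λ m → Cm j F m * negOnePow (foldr (λ k acc → ((l ℕ.+ m) C k) ℕ.+ acc) 0 ks))
                     (upTo (suc j)))

-- G = σ_{n+j,k_1} + ... + σ_{n+j,k_s} + F (F in the first j variables) is
-- trivially balanced: ∃ c ∈ ℤ, ∀ 0 ≤ l ≤ n, δ_l + δ_{n-l} = c (-1)^l.
TriviallyBalanced : List ℕ → (j : ℕ) → (Vec Bool j → Bool) → ℕ → Set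
TriviallyBalanced ks j F n =
  Σ ℤ λ c → ∀ l → l ℕ.≤ n → δ ks j F l + δ ks j F (n ℕ.∸ l) ≡ c * negOnePow l

X₁ : Vec Bool 1 → Bool
X₁ = head

-- Summing over X₁ first gives S(σ_{n+1,k} + X₁) = Σ_l (n choose l) δ_l with δ_l = ε(l) − ε(l+1),
-- where ε(a) = (−1)^(a choose k) only sees the parity of (a choose k). By Lucas' theorem, and
-- because k < 2^r, that parity is invariant under a ↦ k − 1 − a modulo 2^r. Since n + 2 ≡ k
-- (mod 2^r), ε is therefore symmetric about (n+1)/2, i.e. δ_{n−l} = −δ_l: the terms l and n − l
-- cancel in S, and δ_l + δ_{n−l} = 0 is the trivial-balancedness condition with c = 0.

module Submission where

open import Defs
open import Data.Bool using (Bool; true; false; _xor_)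
open import Data.Bool.Properties using (xor-identityʳ; xor-assoc; xor-same; xor-comm)
open import Data.Nat using (ℕ; zero; suc; _+_; _*_; _∸_; _^_; _≤_; _<_; _≥_; z≤n; s≤s)
open import Data.Nat.Properties
  using (*-suc; suc-injective; +-comm; +-suc; *-cancelˡ-≡; *-cancelˡ-<; even≢odd; <-trans; n<1+n; ≰⇒>; <-irrefl;
         ≤-trans; ≤-reflexive; m≤n⇒m≤1+n; m∸n+n≡m; m+[n∸m]≡n; +-∸-assoc; +-identityʳ; +-mono-≤; *-mono-≤; m^n>0)
open import Data.Nat.Combinatorics using (_C_; nCk+nC[k+1]≡[n+1]C[k+1])
open import Data.Nat.Logarithm using (⌊log₂_⌋; ⌊log₂⌋-mono-≤; ⌊log₂[2^n]⌋≡n)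
open import Data.Nat.Tactic.RingSolver using (solve)
open import Data.Integer using (ℤ; +_; -_; _-_) renaming (_+_ to _+ℤ_; _*_ to _*ℤ_)
import Data.Integer.Properties as ℤ
import Data.Integer.Tactic.RingSolver as ℤ-Solver
open import Algebra.Properties.CommutativeSemigroup ℤ.+-commutativeSemigroup using (interchange)
open import Data.List using (List; []; _∷_; map; concatMap)
open import Data.List.Properties using (map-cong)
open import Data.Vec using (Vec; head) renaming ([] to []ᵥ; _∷_ to _∷ᵥ_)
open import Data.Product using (_×_; _,_)
open import Data.Empty using (⊥-elim)
open import Function using (_∘_)
open import Relation.Binary.PropositionalEquality
open ≡-Reasoning

-- Parity of binomial coefficients

infix 8 _C₂_

_C₂_ : ℕ → ℕ → Bool
_     C₂ zero  = true
zero  C₂ suc k = false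
suc n C₂ suc k = n C₂ k xor n C₂ suc k

sgn-xor : ∀ x y → sgn (x xor y) ≡ sgn x *ℤ sgn y
sgn-xor true  true  = refl
sgn-xor true  false = refl
sgn-xor false true  = refl
sgn-xor false false = refl

negOnePow-+ : ∀ m n → negOnePow (m + n) ≡ negOnePow m *ℤ negOnePow n
negOnePow-+ zero    n = sym (ℤ.*-identityˡ (negOnePow n))
negOnePow-+ (suc m) n = trans (cong -_ (negOnePow-+ m n)) (ℤ.neg-distribˡ-* (negOnePow m) (negOnePow n))

negOnePow-C : ∀ n k → negOnePow (n C k) ≡ sgn (n C₂ k)
negOnePow-C n       zero    = refl
negOnePow-C zero    (suc k) = refl
negOnePow-C (suc n) (suc k) = begin
  negOnePow (suc n C suc k)                    ≡⟨ cong negOnePow (nCk+nC[k+1]≡[n+1]C[k+1] n k) ⟨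
  negOnePow (n C k + n C suc k)                ≡⟨ negOnePow-+ (n C k) (n C suc k) ⟩
  negOnePow (n C k) *ℤ negOnePow (n C suc k)   ≡⟨ cong₂ _*ℤ_ (negOnePow-C n k) (negOnePow-C n (suc k)) ⟩
  sgn (n C₂ k) *ℤ sgn (n C₂ suc k)             ≡⟨ sgn-xor (n C₂ k) (n C₂ suc k) ⟨
  sgn (suc n C₂ suc k)                         ∎

σ-weight : ∀ {N} k (x : Vec Bool N) → σ k x ≡ weight x C₂ k
σ-weight zero    x              = refl
σ-weight (suc k) []ᵥ            = refl
σ-weight (suc k) (false ∷ᵥ xs)  = trans (xor-identityʳ _) (σ-weight (suc k) xs)
σ-weight (suc k) (true  ∷ᵥ xs)  =
  trans (cong₂ _xor_ (σ-weight (suc k) xs) (σ-weight k xs)) (xor-comm (weight xs C₂ suc k) (weight xs C₂ k))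

-- The middle term 2·(n+1 choose k+1) of the two-step Pascal rule vanishes mod 2.
[2+n]C₂[2+k]≡nC₂k⊕nC₂[2+k] : ∀ n k → suc (suc n) C₂ suc (suc k) ≡ n C₂ k xor n C₂ suc (suc k)
[2+n]C₂[2+k]≡nC₂k⊕nC₂[2+k] n k = begin
  (x xor y) xor (y xor z)  ≡⟨ xor-assoc x y (y xor z) ⟩
  x xor (y xor (y xor z))  ≡⟨ cong (x xor_) (xor-assoc y y z) ⟨
  x xor ((y xor y) xor z)  ≡⟨ cong (λ w → x xor (w xor z)) (xor-same y) ⟩
  x xor z                  ∎
  where x = n C₂ k; y = n C₂ suc k; z = n C₂ suc (suc k)

[2n]C₂[2k]≡nC₂k : ∀ n k → (2 * n) C₂ (2 * k) ≡ n C₂ k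
[2n]C₂[2k]≡nC₂k n       zero    = refl
[2n]C₂[2k]≡nC₂k zero    (suc k) = refl
[2n]C₂[2k]≡nC₂k (suc n) (suc k) = begin
  (2 * suc n) C₂ (2 * suc k)                          ≡⟨ cong₂ _C₂_ (*-suc 2 n) (*-suc 2 k) ⟩
  (2 + 2 * n) C₂ (2 + 2 * k)                          ≡⟨ [2+n]C₂[2+k]≡nC₂k⊕nC₂[2+k] (2 * n) (2 * k) ⟩
  (2 * n) C₂ (2 * k) xor (2 * n) C₂ (2 + 2 * k)       ≡⟨ cong (λ j → (2 * n) C₂ (2 * k) xor (2 * n) C₂ j) (*-suc 2 k) ⟨
  (2 * n) C₂ (2 * k) xor (2 * n) C₂ (2 * suc k)       ≡⟨ cong₂ _xor_ ([2n]C₂[2k]≡nC₂k n k) ([2n]C₂[2k]≡nC₂k n (suc k)) ⟩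
  suc n C₂ suc k                                      ∎

[2n]C₂[1+2k]≡false : ∀ n k → (2 * n) C₂ suc (2 * k) ≡ false
[2n]C₂[1+2k]≡false zero    k       = refl
[2n]C₂[1+2k]≡false (suc n) zero    =
  trans (cong (_C₂ 1) (*-suc 2 n)) (cong (λ b → true xor (true xor b)) ([2n]C₂[1+2k]≡false n zero))
[2n]C₂[1+2k]≡false (suc n) (suc k) = begin
  (2 * suc n) C₂ suc (2 * suc k)                      ≡⟨ cong₂ (λ i j → i C₂ suc j) (*-suc 2 n) (*-suc 2 k) ⟩
  (2 + 2 * n) C₂ (3 + 2 * k)                          ≡⟨ [2+n]C₂[2+k]≡nC₂k⊕nC₂[2+k] (2 * n) (suc (2 * k)) ⟩
  (2 * n) C₂ suc (2 * k) xor (2 * n) C₂ (3 + 2 * k)   ≡⟨ cong (λ j → (2 * n) C₂ suc (2 * k) xor (2 * n) C₂ suc j) (*-suc 2 k) ⟨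
  (2 * n) C₂ suc (2 * k) xor (2 * n) C₂ suc (2 * suc k)
      ≡⟨ cong₂ _xor_ ([2n]C₂[1+2k]≡false n k) ([2n]C₂[1+2k]≡false n (suc k)) ⟩
  false                                               ∎

[1+2n]C₂[2k]≡nC₂k : ∀ n k → suc (2 * n) C₂ (2 * k) ≡ n C₂ k
[1+2n]C₂[2k]≡nC₂k n zero    = refl
[1+2n]C₂[2k]≡nC₂k n (suc k) = begin
  suc (2 * n) C₂ (2 * suc k)                          ≡⟨ cong (suc (2 * n) C₂_) (*-suc 2 k) ⟩
  (2 * n) C₂ suc (2 * k) xor (2 * n) C₂ (2 + 2 * k)   ≡⟨ cong (λ j → (2 * n) C₂ suc (2 * k) xor (2 * n) C₂ j) (*-suc 2 k) ⟨
  (2 * n) C₂ suc (2 * k) xor (2 * n) C₂ (2 * suc k)   ≡⟨ cong₂ _xor_ ([2n]C₂[1+2k]≡false n k) ([2n]C₂[2k]≡nC₂k n (suc k)) ⟩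
  n C₂ suc k                                          ∎

[1+2n]C₂[1+2k]≡nC₂k : ∀ n k → suc (2 * n) C₂ suc (2 * k) ≡ n C₂ k
[1+2n]C₂[1+2k]≡nC₂k n k =
  trans (cong₂ _xor_ ([2n]C₂[2k]≡nC₂k n k) ([2n]C₂[1+2k]≡false n k)) (xor-identityʳ (n C₂ k))

data EvenOrOdd : ℕ → Set where
  even : ∀ h → EvenOrOdd (2 * h)
  odd  : ∀ h → EvenOrOdd (suc (2 * h))

evenOrOdd : ∀ n → EvenOrOdd n
evenOrOdd zero = even 0
evenOrOdd (suc n) with evenOrOdd n
... | even h = odd h
... | odd  h = subst EvenOrOdd (*-suc 2 h) (even (suc h))

-- a ↦ a C₂ k is invariant under the reflection a ↦ k - 1 - a modulo P.
C₂-Reflective : ℕ → ℕ → Set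
C₂-Reflective P k = ∀ N a b → suc (a + b) ≡ P * N + k → a C₂ k ≡ b C₂ k

C₂-reflective-double : ∀ {P k} → C₂-Reflective P k → C₂-Reflective (2 * P) (2 * k)
C₂-reflective-double {P} {k} reflective N a b = cases (evenOrOdd a) (evenOrOdd b)
  where
  even-odd : ∀ a′ b′ → suc (2 * a′ + suc (2 * b′)) ≡ 2 * P * N + 2 * k →
             (2 * a′) C₂ (2 * k) ≡ suc (2 * b′) C₂ (2 * k)
  even-odd a′ b′ eq = begin
    (2 * a′) C₂ (2 * k)      ≡⟨ [2n]C₂[2k]≡nC₂k a′ k ⟩
    a′ C₂ k                  ≡⟨ reflective N a′ b′ (*-cancelˡ-≡ (suc (a′ + b′)) (P * N + k) 2 halve) ⟩
    b′ C₂ k                  ≡⟨ [1+2n]C₂[2k]≡nC₂k b′ k ⟨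
    suc (2 * b′) C₂ (2 * k)  ∎
    where
    halve : 2 * suc (a′ + b′) ≡ 2 * (P * N + k)
    halve = begin
      2 * suc (a′ + b′)              ≡⟨ solve (a′ ∷ b′ ∷ []) ⟩
      suc (2 * a′ + suc (2 * b′))    ≡⟨ eq ⟩
      2 * P * N + 2 * k              ≡⟨ solve (P ∷ N ∷ k ∷ []) ⟩
      2 * (P * N + k)                ∎

  cases : ∀ {a b} → EvenOrOdd a → EvenOrOdd b → suc (a + b) ≡ 2 * P * N + 2 * k →
          a C₂ (2 * k) ≡ b C₂ (2 * k)
  cases (even a′) (even b′) eq = ⊥-elim (even≢odd (P * N + k) (a′ + b′) (begin
    2 * (P * N + k)          ≡⟨ solve (P ∷ N ∷ k ∷ []) ⟩
    2 * P * N + 2 * k        ≡⟨ eq ⟨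
    suc (2 * a′ + 2 * b′)    ≡⟨ solve (a′ ∷ b′ ∷ []) ⟩
    suc (2 * (a′ + b′))      ∎))
  cases (even a′) (odd  b′) eq = even-odd a′ b′ eq
  cases (odd  a′) (even b′) eq = sym (even-odd b′ a′ (trans (cong suc (+-comm (2 * b′) (suc (2 * a′)))) eq))
  cases (odd  a′) (odd  b′) eq = ⊥-elim (even≢odd (P * N + k) (suc (a′ + b′)) (begin
    2 * (P * N + k)                    ≡⟨ solve (P ∷ N ∷ k ∷ []) ⟩
    2 * P * N + 2 * k                  ≡⟨ eq ⟨
    suc (suc (2 * a′) + suc (2 * b′))  ≡⟨ solve (a′ ∷ b′ ∷ []) ⟩
    suc (2 * suc (a′ + b′))            ∎))

C₂-reflective-double+1 : ∀ {P k} → C₂-Reflective P k → C₂-Reflective (2 * P) (suc (2 * k))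
C₂-reflective-double+1 {P} {k} reflective N a b = cases (evenOrOdd a) (evenOrOdd b)
  where
  cases : ∀ {a b} → EvenOrOdd a → EvenOrOdd b → suc (a + b) ≡ 2 * P * N + suc (2 * k) →
          a C₂ suc (2 * k) ≡ b C₂ suc (2 * k)
  cases (even a′) (even b′) _  = trans ([2n]C₂[1+2k]≡false a′ k) (sym ([2n]C₂[1+2k]≡false b′ k))
  cases (even a′) (odd  b′) eq = ⊥-elim (even≢odd (suc (a′ + b′)) (P * N + k) (begin
    2 * suc (a′ + b′)              ≡⟨ solve (a′ ∷ b′ ∷ []) ⟩
    suc (2 * a′ + suc (2 * b′))    ≡⟨ eq ⟩
    2 * P * N + suc (2 * k)        ≡⟨ solve (P ∷ N ∷ k ∷ []) ⟩
    suc (2 * (P * N + k))          ∎))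
  cases (odd  a′) (even b′) eq = ⊥-elim (even≢odd (suc (a′ + b′)) (P * N + k) (begin
    2 * suc (a′ + b′)              ≡⟨ solve (a′ ∷ b′ ∷ []) ⟩
    suc (suc (2 * a′) + 2 * b′)    ≡⟨ eq ⟩
    2 * P * N + suc (2 * k)        ≡⟨ solve (P ∷ N ∷ k ∷ []) ⟩
    suc (2 * (P * N + k))          ∎))
  cases (odd  a′) (odd  b′) eq = begin
    suc (2 * a′) C₂ suc (2 * k)  ≡⟨ [1+2n]C₂[1+2k]≡nC₂k a′ k ⟩
    a′ C₂ k                      ≡⟨ reflective N a′ b′ (*-cancelˡ-≡ (suc (a′ + b′)) (P * N + k) 2 halve) ⟩
    b′ C₂ k                      ≡⟨ [1+2n]C₂[1+2k]≡nC₂k b′ k ⟨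
    suc (2 * b′) C₂ suc (2 * k)  ∎
    where
    halve : 2 * suc (a′ + b′) ≡ 2 * (P * N + k)
    halve = suc-injective (begin
      suc (2 * suc (a′ + b′))            ≡⟨ solve (a′ ∷ b′ ∷ []) ⟩
      suc (suc (2 * a′) + suc (2 * b′))  ≡⟨ eq ⟩
      2 * P * N + suc (2 * k)            ≡⟨ solve (P ∷ N ∷ k ∷ []) ⟩
      suc (2 * (P * N + k))              ∎)

C₂-reflective : ∀ r {k} → k < 2 ^ r → C₂-Reflective (2 ^ r) k
C₂-reflective zero    {zero}  _ _ _ _ _ = refl
C₂-reflective zero    {suc k} (s≤s ())
C₂-reflective (suc r) {k} k<2^[1+r] with evenOrOdd k
... | even h = C₂-reflective-double {2 ^ r} {h} (C₂-reflective r (*-cancelˡ-< 2 h (2 ^ r) k<2^[1+r]))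
... | odd  h = C₂-reflective-double+1 {2 ^ r} {h} (C₂-reflective r (*-cancelˡ-< 2 h (2 ^ r) (<-trans (n<1+n (2 * h)) k<2^[1+r])))

n<2^[1+⌊log₂n⌋] : ∀ n → n < 2 ^ suc ⌊log₂ n ⌋
n<2^[1+⌊log₂n⌋] n = ≰⇒> λ 2^[1+⌊log₂n⌋]≤n →
  <-irrefl refl (≤-trans (≤-reflexive (sym (⌊log₂[2^n]⌋≡n (suc ⌊log₂ n ⌋)))) (⌊log₂⌋-mono-≤ 2^[1+⌊log₂n⌋]≤n))

sumℤ-map-+ : ∀ {A : Set} (f g : A → ℤ) (xs : List A) →
             sumℤ (map (λ x → f x +ℤ g x) xs) ≡ sumℤ (map f xs) +ℤ sumℤ (map g xs)
sumℤ-map-+ f g []       = refl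
sumℤ-map-+ f g (x ∷ xs) = trans (cong (f x +ℤ g x +ℤ_) (sumℤ-map-+ f g xs))
                                (interchange (f x) (g x) (sumℤ (map f xs)) (sumℤ (map g xs)))

sumℤ-allVecs-suc : ∀ N (f : Vec Bool (suc N) → ℤ) →
                   sumℤ (map f (allVecs (suc N))) ≡ sumℤ (map (λ v → f (false ∷ᵥ v) +ℤ f (true ∷ᵥ v)) (allVecs N))
sumℤ-allVecs-suc N f = go (allVecs N)
  where
  go : ∀ vs → sumℤ (map f (concatMap (λ v → (false ∷ᵥ v) ∷ (true ∷ᵥ v) ∷ []) vs))
            ≡ sumℤ (map (λ v → f (false ∷ᵥ v) +ℤ f (true ∷ᵥ v)) vs)
  go []       = refl
  go (v ∷ vs) = trans (sym (ℤ.+-assoc (f (false ∷ᵥ v)) (f (true ∷ᵥ v)) _))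
                      (cong (f (false ∷ᵥ v) +ℤ f (true ∷ᵥ v) +ℤ_) (go vs))

-- Σ_{a ≤ n} (n choose a) g(a), computed along Pascal's rule.
binomialSum : ℕ → (ℕ → ℤ) → ℤ
binomialSum zero    g = g 0
binomialSum (suc n) g = binomialSum n g +ℤ binomialSum n (g ∘ suc)

sumℤ-allVecs-weight : ∀ N (g : ℕ → ℤ) → sumℤ (map (g ∘ weight) (allVecs N)) ≡ binomialSum N g
sumℤ-allVecs-weight zero    g = ℤ.+-identityʳ (g 0)
sumℤ-allVecs-weight (suc N) g = begin
  sumℤ (map (g ∘ weight) (allVecs (suc N)))                               ≡⟨ sumℤ-allVecs-suc N (g ∘ weight) ⟩
  sumℤ (map (λ v → g (weight v) +ℤ g (suc (weight v))) (allVecs N))       ≡⟨ sumℤ-map-+ (g ∘ weight) (g ∘ suc ∘ weight) (allVecs N) ⟩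
  sumℤ (map (g ∘ weight) (allVecs N)) +ℤ sumℤ (map (g ∘ suc ∘ weight) (allVecs N))
      ≡⟨ cong₂ _+ℤ_ (sumℤ-allVecs-weight N g) (sumℤ-allVecs-weight N (g ∘ suc)) ⟩
  binomialSum (suc N) g                                                   ∎

binomialSum-cong : ∀ n {g h : ℕ → ℤ} → (∀ a → a ≤ n → g a ≡ h a) → binomialSum n g ≡ binomialSum n h
binomialSum-cong zero    g≡h = g≡h 0 z≤n
binomialSum-cong (suc n) g≡h = cong₂ _+ℤ_ (binomialSum-cong n (λ a a≤n → g≡h a (m≤n⇒m≤1+n a≤n)))
                                          (binomialSum-cong n (λ a a≤n → g≡h (suc a) (s≤s a≤n)))

binomialSum-reflect : ∀ n (g : ℕ → ℤ) → binomialSum n g ≡ binomialSum n (λ a → g (n ∸ a))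
binomialSum-reflect zero    g = refl
binomialSum-reflect (suc n) g = begin
  binomialSum n g +ℤ binomialSum n (g ∘ suc)                             ≡⟨ ℤ.+-comm (binomialSum n g) _ ⟩
  binomialSum n (g ∘ suc) +ℤ binomialSum n g                             ≡⟨ cong₂ _+ℤ_ (binomialSum-reflect n (g ∘ suc)) (binomialSum-reflect n g) ⟩
  binomialSum n (λ a → g (suc (n ∸ a))) +ℤ binomialSum n (λ a → g (n ∸ a))
      ≡⟨ cong (_+ℤ binomialSum n (λ a → g (n ∸ a))) (binomialSum-cong n (λ a a≤n → cong g (sym (+-∸-assoc 1 a≤n)))) ⟩
  binomialSum (suc n) (λ a → g (suc n ∸ a))                              ∎

binomialSum-neg : ∀ n (g : ℕ → ℤ) → binomialSum n (-_ ∘ g) ≡ - binomialSum n g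
binomialSum-neg zero    g = refl
binomialSum-neg (suc n) g = trans (cong₂ _+ℤ_ (binomialSum-neg n g) (binomialSum-neg n (g ∘ suc)))
                                  (sym (ℤ.neg-distrib-+ (binomialSum n g) (binomialSum n (g ∘ suc))))

i≡-i⇒i≡0 : ∀ {i} → i ≡ - i → i ≡ + 0
i≡-i⇒i≡0 {+ zero} _ = refl

binomialSum-antisymmetric : ∀ n (g : ℕ → ℤ) → (∀ l → l ≤ n → g (n ∸ l) ≡ - g l) → binomialSum n g ≡ + 0
binomialSum-antisymmetric n g antisym = i≡-i⇒i≡0 (begin
  binomialSum n g                      ≡⟨ binomialSum-reflect n g ⟩
  binomialSum n (λ l → g (n ∸ l))      ≡⟨ binomialSum-cong n antisym ⟩
  binomialSum n (-_ ∘ g)               ≡⟨ binomialSum-neg n g ⟩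
  - binomialSum n g                    ∎)

sgn-xor-true : ∀ b → sgn (b xor true) ≡ - sgn b
sgn-xor-true true  = refl
sgn-xor-true false = refl

δ-σ+X₁ : ∀ k l → δ (k ∷ []) 1 X₁ l ≡ sgn (l C₂ k) - sgn (suc l C₂ k)
δ-σ+X₁ k l
  rewrite +-identityʳ l | +-comm l 1 | +-identityʳ (l C k) | +-identityʳ (suc l C k) =
  cong₂ _+ℤ_ (trans (ℤ.*-identityˡ _) (negOnePow-C l k))
             (trans (ℤ.+-identityʳ _) (trans (ℤ.-1*i≡-i _) (cong -_ (negOnePow-C (suc l) k))))

S-σ+X₁ : ∀ k n → S (suc n) (λ x → σ k x xor head x) ≡ binomialSum n (δ (k ∷ []) 1 X₁)
S-σ+X₁ k n = begin
  S (suc n) (λ x → σ k x xor head x)                                         ≡⟨ sumℤ-allVecs-suc n (sgn ∘ G) ⟩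
  sumℤ (map (λ v → sgn (G (false ∷ᵥ v)) +ℤ sgn (G (true ∷ᵥ v))) (allVecs n)) ≡⟨ cong sumℤ (map-cong pointwise (allVecs n)) ⟩
  sumℤ (map (δ (k ∷ []) 1 X₁ ∘ weight) (allVecs n))                          ≡⟨ sumℤ-allVecs-weight n (δ (k ∷ []) 1 X₁) ⟩
  binomialSum n (δ (k ∷ []) 1 X₁)                                            ∎
  where
  G : Vec Bool (suc n) → Bool
  G x = σ k x xor head x

  pointwise : ∀ v → sgn (G (false ∷ᵥ v)) +ℤ sgn (G (true ∷ᵥ v)) ≡ δ (k ∷ []) 1 X₁ (weight v)
  pointwise v = begin
    sgn (G (false ∷ᵥ v)) +ℤ sgn (G (true ∷ᵥ v))
      ≡⟨ cong₂ _+ℤ_ (cong sgn (xor-identityʳ (σ k (false ∷ᵥ v)))) (sgn-xor-true (σ k (true ∷ᵥ v))) ⟩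
    sgn (σ k (false ∷ᵥ v)) - sgn (σ k (true ∷ᵥ v))
      ≡⟨ cong₂ (λ b c → sgn b - sgn c) (σ-weight k (false ∷ᵥ v)) (σ-weight k (true ∷ᵥ v)) ⟩
    sgn (weight v C₂ k) - sgn (suc (weight v) C₂ k)
      ≡⟨ δ-σ+X₁ k (weight v) ⟨
    δ (k ∷ []) 1 X₁ (weight v) ∎

difference-antisymmetric : ∀ n (f : ℕ → ℤ) → (∀ a b → a + b ≡ suc n → f a ≡ f b) →
                           ∀ l → l ≤ n → f (n ∸ l) - f (suc (n ∸ l)) ≡ - (f l - f (suc l))
difference-antisymmetric n f symmetric l l≤n = begin
  f (n ∸ l) - f (suc (n ∸ l))   ≡⟨ cong₂ _-_ (symmetric (n ∸ l) (suc l) (trans (+-suc (n ∸ l) l) (cong suc (m∸n+n≡m l≤n))))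
                                             (symmetric (suc (n ∸ l)) l (cong suc (m∸n+n≡m l≤n))) ⟩
  f (suc l) - f l               ≡⟨ j-i≡-[i-j] (f l) (f (suc l)) ⟩
  - (f l - f (suc l))           ∎
  where
  j-i≡-[i-j] : ∀ i j → j - i ≡ - (i - j)
  j-i≡-[i-j] = ℤ-Solver.solve-∀

δ-antisymmetric : ∀ r {k m n} → k < 2 ^ r → suc (suc n) ≡ 2 ^ r * m + k →
                  ∀ l → l ≤ n → δ (k ∷ []) 1 X₁ (n ∸ l) ≡ - δ (k ∷ []) 1 X₁ l
δ-antisymmetric r {k} {m} {n} k<2^r 2+n≡2^rm+k l l≤n = begin
  δ (k ∷ []) 1 X₁ (n ∸ l)                          ≡⟨ δ-σ+X₁ k (n ∸ l) ⟩
  sgn ((n ∸ l) C₂ k) - sgn (suc (n ∸ l) C₂ k)      ≡⟨ difference-antisymmetric n (λ a → sgn (a C₂ k)) symmetric l l≤n ⟩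
  - (sgn (l C₂ k) - sgn (suc l C₂ k))              ≡⟨ cong -_ (δ-σ+X₁ k l) ⟨
  - δ (k ∷ []) 1 X₁ l                              ∎
  where
  symmetric : ∀ a b → a + b ≡ suc n → sgn (a C₂ k) ≡ sgn (b C₂ k)
  symmetric a b a+b≡1+n = cong sgn (C₂-reflective r k<2^r m a b (trans (cong suc a+b≡1+n) 2+n≡2^rm+k))

theorem4p1 : (k : ℕ) → k ≥ 1 → (m : ℕ) → m ≥ 1 →
  let r = suc ⌊log₂ k ⌋
      n = 2 ^ r * m + k ∸ 2
  in Balanced (suc n) (λ x → σ k x xor head x)
     × TriviallyBalanced (k ∷ []) 1 X₁ n
theorem4p1 k k≥1 m m≥1 = balanced , + 0 , trivially
  where
  r = suc ⌊log₂ k ⌋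
  n = 2 ^ r * m + k ∸ 2

  2+n≡2^rm+k : suc (suc n) ≡ 2 ^ r * m + k
  2+n≡2^rm+k = m+[n∸m]≡n (+-mono-≤ (*-mono-≤ (m^n>0 2 r) m≥1) k≥1)

  antisymmetric : ∀ l → l ≤ n → δ (k ∷ []) 1 X₁ (n ∸ l) ≡ - δ (k ∷ []) 1 X₁ l
  antisymmetric = δ-antisymmetric r (n<2^[1+⌊log₂n⌋] k) 2+n≡2^rm+k

  balanced : Balanced (suc n) (λ x → σ k x xor head x)
  balanced = trans (S-σ+X₁ k n) (binomialSum-antisymmetric n (δ (k ∷ []) 1 X₁) antisymmetric)

  trivially : ∀ l → l ≤ n → δ (k ∷ []) 1 X₁ l +ℤ δ (k ∷ []) 1 X₁ (n ∸ l) ≡ + 0 *ℤ negOnePow l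
  trivially l l≤n = trans (cong (δ (k ∷ []) 1 X₁ l +ℤ_) (antisymmetric l l≤n)) (ℤ.+-inverseʳ (δ (k ∷ []) 1 X₁ l))
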